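{- Let $f:\{0,1\}^n\to\{0,1\}$ and let $\mathcal{D}$ be a probability distribution over $\{0,1\}^n$ such that $f$ is $\epsilon$-far from $k$-juntas with respect to $\mathcal{D}$. Then for every $I\subseteq[n]$ with $|I|\le k$, $$\Pr_{x\sim\mathcal{D},\,w\sim\{0,1\}^n}\big[f(x)\neq f(x_I\circ w_{\overline{I}})\big]\ge \epsilon/2,$$ where $w$ is uniform over $\{0,1\}^n$ and independent of $x$.
   Context: $\overline{I}=[n]\setminus I$. For $x\in\{0,1\}^n$ and $B\subseteq[n]$, $x_B$ is the projection of $x$ onto the coordinates in $B$, and $x_I\circ w_{\overline I}$ is the string agreeing with $x$ on $I$ and with $w$ on $\overline I$. A $k$-junta is a Boolean function depending on at most $k$ variables; $f$ is $\epsilon$-far from $k$-juntas with respect to $\mathcal{D}$ if $\Pr_{x\sim\mathcal{D}}[f(x)\ne g(x)]\ge\epsilon$ for every $k$-junta $g:\{0,1\}^n\to\{0,1\}$.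
   Formalization: The probabilities assigned by the distribution $\mathcal{D}$ and the parameter $\epsilon$ are rational. -}

module Defs where

open import Data.Nat using (ℕ; zero; suc)
open import Data.Bool using (Bool; true; false; if_then_else_)
open import Data.Vec using (Vec; []; _∷_; lookup; tabulate)
open import Data.List using (List; []; _∷_; _++_; map)
open import Data.Fin using (Fin)
open import Data.Fin.Subset using (Subset; _∈_; ∣_∣)
open import Data.Rational using (ℚ; 0ℚ; 1ℚ; ½; _+_; _*_; _≤_)
open import Relation.Nullary using (¬_)
open import Relation.Binary.PropositionalEquality using (_≡_)
open import Data.Product using (Σ; _×_)

Cube : ℕ → Set
Cube n = Vec Bool n

cube : (n : ℕ) → List (Cube n)
cube zero    = [] ∷ []
cube (suc n) = map (false ∷_) (cube n) ++ map (true ∷_) (cube n)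

sumL : {A : Set} → (A → ℚ) → List A → ℚ
sumL f []       = 0ℚ
sumL f (a ∷ as) = f a + sumL f as

Σcube : (n : ℕ) → (Cube n → ℚ) → ℚ
Σcube n f = sumL f (cube n)

record Distribution (n : ℕ) : Set where
  field
    weight    : Cube n → ℚ
    nonneg    : ∀ x → 0ℚ ≤ weight x
    sums-to-1 : Σcube n weight ≡ 1ℚ
open Distribution public

halfPow : ℕ → ℚ
halfPow zero    = 1ℚ
halfPow (suc n) = ½ * halfPow n

uniformWeight : (n : ℕ) → Cube n → ℚ
uniformWeight n _ = halfPow n

neqInd : Bool → Bool → ℚ
neqInd false false = 0ℚ
neqInd true  true  = 0ℚ
neqInd _     _     = 1ℚ

distD : {n : ℕ} → Distribution n → (Cube n → Bool) → (Cube n → Bool) → ℚ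
distD {n} D f g = Σcube n (λ x → weight D x * neqInd (f x) (g x))

IsJunta : (n k : ℕ) → (Cube n → Bool) → Set
IsJunta n k g =
  Σ (Subset n) λ J → (∣ J ∣ Data.Nat.≤ k) ×
    (∀ (x y : Cube n) → (∀ (i : Fin n) → i ∈ J → lookup x i ≡ lookup y i) → g x ≡ g y)

FarFromJuntas : {n : ℕ} → (k : ℕ) → ℚ → Distribution n → (Cube n → Bool) → Set
FarFromJuntas {n} k ε D f = ∀ (g : Cube n → Bool) → IsJunta n k g → ε ≤ distD D f g

splice : {n : ℕ} → Subset n → Cube n → Cube n → Cube n
splice I x w = tabulate (λ i → if lookup I i then lookup x i else lookup w i)

resampleProb : {n : ℕ} → Distribution n → (Cube n → Bool) → Subset n → ℚ
resampleProb {n} D f I =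
  Σcube n (λ x → Σcube n (λ w →
    (weight D x * uniformWeight n w) * neqInd (f x) (f (splice I x w))))

{-# OPTIONS --safe #-}
module Submission where

-- Freezing the resampled part w turns x ↦ f (x_I ∘ w_Ī) into a junta on the
-- coordinates I, so by farness it disagrees with f on D-mass at least ε.
-- Averaging over w shows the resampling probability is at least ε itself;
-- the stated bound ε/2 then needs only that this probability is nonnegative
-- (ε is not assumed nonnegative).

open import Defs
open import Data.Nat using (ℕ; zero; suc)
open import Data.Bool using (Bool; true; false; if_then_else_)
open import Data.Fin.Subset using (Subset; _∈_; ∣_∣)
open import Data.Rational using (ℚ; 0ℚ; 1ℚ; ½; _+_; _*_; _≤_; nonNegative)
open import Data.Rational.Properties
  using ( ≤-refl; ≤-trans; _≤?_; +-mono-≤; *-monoˡ-≤-nonNeg; *-monoʳ-≤-nonNeg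
        ; nonNegative⁻¹; nonNeg*nonNeg⇒nonNeg; +-identityˡ; +-assoc; *-comm
        ; *-identityʳ; *-zeroʳ; *-assoc; *-distribˡ-+; +-0-commutativeMonoid
        ; module ≤-Reasoning)
open import Algebra.Bundles using (CommutativeMonoid)
open import Algebra.Properties.CommutativeSemigroup
  (CommutativeMonoid.commutativeSemigroup +-0-commutativeMonoid) using (interchange)
open import Data.List using (List; []; _∷_; _++_; map)
open import Data.Vec using (lookup) renaming (_∷_ to _∷ᵛ_)
open import Data.Vec.Properties using (tabulate-cong; lookup⇒[]=)
open import Data.Product using (_,_)
open import Relation.Nullary.Decidable using (from-yes)
open import Relation.Binary.PropositionalEquality
  using (_≡_; refl; sym; trans; cong; cong₂; subst; module ≡-Reasoning)

*-nonNeg : ∀ {p q} → 0ℚ ≤ p → 0ℚ ≤ q → 0ℚ ≤ p * q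
*-nonNeg {p} {q} 0≤p 0≤q =
  nonNegative⁻¹ (p * q) {{nonNeg*nonNeg⇒nonNeg p {{nonNegative 0≤p}} q {{nonNegative 0≤q}}}}

*½-≤ : ∀ {q} → 0ℚ ≤ q → q * ½ ≤ q
*½-≤ {q} 0≤q = begin
  q * ½   ≤⟨ *-monoˡ-≤-nonNeg q {{nonNegative 0≤q}} (from-yes (½ ≤? 1ℚ)) ⟩
  q * 1ℚ  ≡⟨ *-identityʳ q ⟩
  q       ∎
  where open ≤-Reasoning

module _ {A : Set} where

  sumL-cong : ∀ {f g : A → ℚ} (L : List A) → (∀ a → f a ≡ g a) → sumL f L ≡ sumL g L
  sumL-cong []      f≡g = refl
  sumL-cong (a ∷ L) f≡g = cong₂ _+_ (f≡g a) (sumL-cong L f≡g)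

  sumL-mono-≤ : ∀ {f g : A → ℚ} (L : List A) → (∀ a → f a ≤ g a) → sumL f L ≤ sumL g L
  sumL-mono-≤ []      f≤g = ≤-refl
  sumL-mono-≤ (a ∷ L) f≤g = +-mono-≤ (f≤g a) (sumL-mono-≤ L f≤g)

  sumL-nonNeg : ∀ {f : A → ℚ} (L : List A) → (∀ a → 0ℚ ≤ f a) → 0ℚ ≤ sumL f L
  sumL-nonNeg []      0≤f = ≤-refl
  sumL-nonNeg (a ∷ L) 0≤f = +-mono-≤ (0≤f a) (sumL-nonNeg L 0≤f)

  sumL-zero : (L : List A) → sumL (λ _ → 0ℚ) L ≡ 0ℚ
  sumL-zero []      = refl
  sumL-zero (a ∷ L) = trans (+-identityˡ _) (sumL-zero L)

  sumL-+ : (f g : A → ℚ) (L : List A) → sumL (λ a → f a + g a) L ≡ sumL f L + sumL g L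
  sumL-+ f g []      = refl
  sumL-+ f g (a ∷ L) =
    trans (cong (f a + g a +_) (sumL-+ f g L)) (interchange (f a) (g a) (sumL f L) (sumL g L))

  *-distribˡ-sumL : (c : ℚ) (f : A → ℚ) (L : List A) → sumL (λ a → c * f a) L ≡ c * sumL f L
  *-distribˡ-sumL c f []      = sym (*-zeroʳ c)
  *-distribˡ-sumL c f (a ∷ L) =
    trans (cong (c * f a +_) (*-distribˡ-sumL c f L)) (sym (*-distribˡ-+ c (f a) _))

  sumL-++ : (f : A → ℚ) (xs ys : List A) → sumL f (xs ++ ys) ≡ sumL f xs + sumL f ys
  sumL-++ f []       ys = sym (+-identityˡ _)
  sumL-++ f (x ∷ xs) ys = trans (cong (f x +_) (sumL-++ f xs ys)) (sym (+-assoc (f x) _ _))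

  sumL-map : {B : Set} (f : B → ℚ) (g : A → B) (xs : List A) →
    sumL f (map g xs) ≡ sumL (λ a → f (g a)) xs
  sumL-map f g []       = refl
  sumL-map f g (x ∷ xs) = cong (f (g x) +_) (sumL-map f g xs)

  sumL-weighted-≥ : ∀ {c} (p f : A → ℚ) (L : List A) →
    (∀ a → 0ℚ ≤ p a) → sumL p L ≡ 1ℚ → (∀ a → c ≤ f a) → c ≤ sumL (λ a → p a * f a) L
  sumL-weighted-≥ {c} p f L 0≤p Σp≡1 c≤f = begin
    c                       ≡⟨ sym (*-identityʳ c) ⟩
    c * 1ℚ                  ≡⟨ cong (c *_) (sym Σp≡1) ⟩
    c * sumL p L            ≡⟨ sym (*-distribˡ-sumL c p L) ⟩
    sumL (λ a → c * p a) L  ≤⟨ sumL-mono-≤ L cp≤pf ⟩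
    sumL (λ a → p a * f a) L ∎
    where
    open ≤-Reasoning
    cp≤pf : ∀ a → c * p a ≤ p a * f a
    cp≤pf a = subst (_≤ p a * f a) (*-comm (p a) c)
                    (*-monoˡ-≤-nonNeg (p a) {{nonNegative (0≤p a)}} (c≤f a))

sumL-swap : {A B : Set} (h : A → B → ℚ) (L₁ : List A) (L₂ : List B) →
  sumL (λ a → sumL (h a) L₂) L₁ ≡ sumL (λ b → sumL (λ a → h a b) L₁) L₂
sumL-swap h []       L₂ = sym (sumL-zero L₂)
sumL-swap h (a ∷ L₁) L₂ =
  trans (cong (sumL (h a) L₂ +_) (sumL-swap h L₁ L₂))
        (sym (sumL-+ (h a) (λ b → sumL (λ a → h a b) L₁) L₂))

Σcube-suc : ∀ n (h : Cube (suc n) → ℚ) →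
  Σcube (suc n) h ≡ Σcube n (λ x → h (false ∷ᵛ x)) + Σcube n (λ x → h (true ∷ᵛ x))
Σcube-suc n h = trans (sumL-++ h (map (false ∷ᵛ_) (cube n)) _)
                      (cong₂ _+_ (sumL-map h _ (cube n)) (sumL-map h _ (cube n)))

halfPow-nonNeg : ∀ n → 0ℚ ≤ halfPow n
halfPow-nonNeg zero    = nonNegative⁻¹ 1ℚ
halfPow-nonNeg (suc n) = *-nonNeg (nonNegative⁻¹ ½) (halfPow-nonNeg n)

uniformWeight-sum : ∀ n → Σcube n (uniformWeight n) ≡ 1ℚ
uniformWeight-sum zero    = refl
uniformWeight-sum (suc n) = begin
  Σcube (suc n) (uniformWeight (suc n))          ≡⟨ Σcube-suc n (uniformWeight (suc n)) ⟩
  Σcube n (λ _ → ½ * halfPow n) + Σcube n (λ _ → ½ * halfPow n)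
    ≡⟨ cong₂ _+_ half half ⟩
  ½ + ½                                          ≡⟨⟩
  1ℚ                                             ∎
  where
  open ≡-Reasoning
  half : Σcube n (λ _ → ½ * halfPow n) ≡ ½
  half = trans (*-distribˡ-sumL ½ (uniformWeight n) (cube n))
               (trans (cong (½ *_) (uniformWeight-sum n)) (*-identityʳ ½))

neqInd-nonNeg : ∀ a b → 0ℚ ≤ neqInd a b
neqInd-nonNeg false false = ≤-refl
neqInd-nonNeg false true  = nonNegative⁻¹ 1ℚ
neqInd-nonNeg true  false = nonNegative⁻¹ 1ℚ
neqInd-nonNeg true  true  = ≤-refl

distD-nonNeg : ∀ {n} (D : Distribution n) (f g : Cube n → Bool) → 0ℚ ≤ distD D f g
distD-nonNeg {n} D f g =
  sumL-nonNeg (cube n) (λ x → *-nonNeg (nonneg D x) (neqInd-nonNeg (f x) (g x)))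

splice-cong : ∀ {n} (I : Subset n) (x y w : Cube n) →
  (∀ i → i ∈ I → lookup x i ≡ lookup y i) → splice I x w ≡ splice I y w
splice-cong I x y w x≡y-on-I = tabulate-cong agree
  where
  agree : ∀ i → (if lookup I i then lookup x i else lookup w i)
              ≡ (if lookup I i then lookup y i else lookup w i)
  agree i with lookup I i in i∈I
  ... | true  = x≡y-on-I i (lookup⇒[]= i I i∈I)
  ... | false = refl

splice-isJunta : ∀ {n k} (I : Subset n) → ∣ I ∣ Data.Nat.≤ k →
  (h : Cube n → Bool) (w : Cube n) → IsJunta n k (λ x → h (splice I x w))
splice-isJunta I ∣I∣≤k h w = I , ∣I∣≤k , λ x y x≡y-on-I → cong h (splice-cong I x y w x≡y-on-I)

resampleProb-average : ∀ {n} (D : Distribution n) (f : Cube n → Bool) (I : Subset n) →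
  resampleProb D f I ≡
    Σcube n (λ w → uniformWeight n w * distD D f (λ x → f (splice I x w)))
resampleProb-average {n} D f I = begin
  resampleProb D f I                        ≡⟨ sumL-swap term (cube n) (cube n) ⟩
  Σcube n (λ w → Σcube n (λ x → term x w))  ≡⟨ sumL-cong (cube n) (λ w →
    trans (sumL-cong (cube n) (reassoc w))
          (*-distribˡ-sumL (uniformWeight n w) _ (cube n))) ⟩
  Σcube n (λ w → uniformWeight n w * distD D f (λ x → f (splice I x w))) ∎
  where
  open ≡-Reasoning
  term : Cube n → Cube n → ℚ
  term x w = (weight D x * uniformWeight n w) * neqInd (f x) (f (splice I x w))
  reassoc : ∀ w x →
    term x w ≡ uniformWeight n w * (weight D x * neqInd (f x) (f (splice I x w)))
  reassoc w x = trans (cong (_* neqInd (f x) (f (splice I x w))) (*-comm (weight D x) _))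
                      (*-assoc (uniformWeight n w) (weight D x) _)

resampleProb-≥ : ∀ {n} {c : ℚ} (D : Distribution n) (f : Cube n → Bool) (I : Subset n) →
  (∀ w → c ≤ distD D f (λ x → f (splice I x w))) → c ≤ resampleProb D f I
resampleProb-≥ {n} D f I c≤dist =
  subst (_ ≤_) (sym (resampleProb-average D f I))
    (sumL-weighted-≥ (uniformWeight n) _ (cube n)
      (λ _ → halfPow-nonNeg n) (uniformWeight-sum n) c≤dist)

lemma5 : (n k : ℕ) (ε : ℚ) (D : Distribution n) (f : Cube n → Bool) →
    FarFromJuntas k ε D f →
    (I : Subset n) → ∣ I ∣ Data.Nat.≤ k →
    ε * ½ ≤ resampleProb D f I
lemma5 n k ε D f far I ∣I∣≤k =
  ≤-trans (*-monoʳ-≤-nonNeg ½ ε≤R) (*½-≤ 0≤R)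
  where
  ε≤R : ε ≤ resampleProb D f I
  ε≤R = resampleProb-≥ D f I (λ w → far _ (splice-isJunta I ∣I∣≤k f w))
  0≤R : 0ℚ ≤ resampleProb D f I
  0≤R = resampleProb-≥ D f I (λ w → distD-nonNeg D f _)
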